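{- If $T$ is a tree, then $\operatorname{svs}(T)\ge \mathfrak{H}(T)$.
   Context: A weak homomorphism $f:G\to H$ is a map $f:V(G)\to V(H)$ such that for every edge $uv\in E(G)$, either $f(u)f(v)\in E(H)$ or $f(u)=f(v)$; it is surjective if $f(V(G))=V(H)$. For weak homomorphisms $f,g:G\to H$, $m_G(f,g)=\min\{d_H(f(u),g(u))\mid u\in V(G)\}$. For a connected graph $H$, the strong vertex span is $\operatorname{svs}(H)=\max\{m_P(f,g)\mid P \text{ is a path and } f,g:P\to H \text{ are surjective weak homomorphisms}\}$. For a vertex $v$ of a tree $T$, the components of $T-\{v\}$ are its maximal connected subgraphs; for such a component $C(v)$, $\operatorname{reach}(C(v))=\max\{d(v,u)\mid u\in V(C(v))\cup\{v\}\}$. Denote the components of $T-\{v\}$ by $C_1(v),\dots,C_{\deg(v)}(v)$ with $\operatorname{reach}(C_i(v))\ge\operatorname{reach}(C_{i+1}(v))$. The triod size of $v$ is $\eta(v)=\operatorname{reach}(C_3(v))$ if $\deg(v)\ge 3$ and $\eta(v)=0$ if $\deg(v)\le 2$; the triod size of $T$ is $\mathfrak{H}(T)=\max\{\eta(v)\mid v\in V(T)\}$. -}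

module Defs where

open import Data.Nat using (ℕ; zero; suc; _≤_; _⊔_)
open import Data.Nat.Properties using (≤-decTotalOrder)
open import Data.Bool using (Bool; true; false; _∧_; _∨_; not; if_then_else_; T)
open import Data.Fin using (Fin; toℕ; inject₁) renaming (suc to fsuc)
open import Data.Fin.Properties using () renaming (_≟_ to _≟F_)
open import Data.List using (List; []; _∷_; map; filter; foldr; allFin; reverse; length)
open import Data.Bool.ListAction using (any)
open import Data.List.Sort.MergeSort ≤-decTotalOrder using (sort)
open import Data.Product using (Σ; _×_; _,_; ∃)
open import Data.Sum using (_⊎_)
open import Relation.Binary.PropositionalEquality using (_≡_; _≢_)
open import Relation.Nullary.Decidable using (⌊_⌋)
import Data.Nat as ℕ

record Graph : Set where
  field
    n   : ℕ
    adj : Fin n → Fin n → Bool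

open Graph public

V : Graph → Set
V G = Fin (n G)

IsSimple : Graph → Set
IsSimple G = (∀ x y → adj G x y ≡ adj G y x) × (∀ x → adj G x x ≡ false)

-- walkB G ok j x y = true  iff there is a walk from x to y with at most
-- j edges all of whose vertices satisfy ok.
walkB : (G : Graph) → (V G → Bool) → ℕ → V G → V G → Bool
walkB G ok zero    x y = ok x ∧ ⌊ x ≟F y ⌋
walkB G ok (suc j) x y =
  walkB G ok j x y ∨
  (ok x ∧ any (λ z → adj G x z ∧ walkB G ok j z y) (allFin (n G)))

everywhere : (G : Graph) → V G → Bool
everywhere G _ = true

Connected : Graph → Set
Connected G = ∀ x y → T (walkB G (everywhere G) (n G) x y)

-- least j < b with p j ≡ true (or b if there is none)
least : (ℕ → Bool) → ℕ → ℕ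
least p zero    = zero
least p (suc b) = if p zero then zero else suc (least (λ j → p (suc j)) b)

-- graph distance d_G(x,y) (length of a shortest walk); in a connected
-- graph with n vertices it is < n, so the search bound n suffices.
dist : (G : Graph) → V G → V G → ℕ
dist G x y = least (λ j → walkB G (everywhere G) j x y) (n G)

HasCycle : Graph → Set
HasCycle G = Σ ℕ λ k → Σ (Fin (suc (suc (suc k))) → V G) λ c →
  (∀ i j → c i ≡ c j → i ≡ j) ×
  (∀ (i : Fin (suc (suc k))) → T (adj G (c (inject₁ i)) (c (fsuc i)))) ×
  T (adj G (c (Data.Fin.fromℕ (suc (suc k)))) (c Data.Fin.zero))

IsTree : Graph → Set
IsTree G = IsSimple G × (1 ≤ n G) × Connected G × (HasCycle G → Data.Empty.⊥)
  where import Data.Empty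

Path : ℕ → Graph
Path m = record
  { n   = suc m
  ; adj = λ i j → ⌊ suc (toℕ i) ℕ.≟ toℕ j ⌋ ∨ ⌊ suc (toℕ j) ℕ.≟ toℕ i ⌋ }

WeakHom : (G H : Graph) → (V G → V H) → Set
WeakHom G H f = ∀ u v → T (adj G u v) → T (adj H (f u) (f v)) ⊎ f u ≡ f v

Surjective : (G H : Graph) → (V G → V H) → Set
Surjective G H f = ∀ y → ∃ λ x → f x ≡ y

-- svs(H) ≥ k  (svs is a maximum, so this unfolds to the existence of a
-- witnessing path P and surjective weak homomorphisms f g with
-- m_P(f,g) = min_u d_H(f u, g u) ≥ k)
SvsAtLeast : Graph → ℕ → Set
SvsAtLeast H k = Σ ℕ λ m → Σ (V (Path m) → V H) λ f → Σ (V (Path m) → V H) λ g →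
  WeakHom (Path m) H f × Surjective (Path m) H f ×
  WeakHom (Path m) H g × Surjective (Path m) H g ×
  (∀ u → k ≤ dist H (f u) (g u))

maxList : List ℕ → ℕ
maxList = foldr _⊔_ 0

avoid : (G : Graph) → V G → V G → Bool
avoid G v x = not ⌊ x ≟F v ⌋

-- u lies in the component of T - {v} containing a
inComp : (G : Graph) → V G → V G → V G → Bool
inComp G v a u = walkB G (avoid G v) (n G) a u

-- neighbours of v; in a tree the components of T - {v} are exactly the
-- components C(a) containing the neighbours a of v, one for each a.
neighbours : (G : Graph) → V G → List (V G)
neighbours G v = filter (λ a → T? (adj G v a)) (allFin (n G))
  where
    open import Relation.Nullary using (Dec; yes; no)
    T? : (b : Bool) → Dec (T b)
    T? true  = yes Data.Unit.tt where import Data.Unit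
    T? false = no (λ ())

-- reach(C(a)) = max { d(v,u) | u ∈ V(C(a)) ∪ {v} }
reach : (G : Graph) → V G → V G → ℕ
reach G v a = maxList (map (λ u → if inComp G v a u then dist G v u else 0)
                           (allFin (n G)))

sortedReaches : (G : Graph) → V G → List ℕ
sortedReaches G v = reverse (sort (map (reach G v) (neighbours G v)))

third : List ℕ → ℕ
third (_ ∷ _ ∷ x ∷ _) = x
third _               = 0

-- η(v) = reach(C₃(v)) if deg v ≥ 3, and 0 otherwise
η : (G : Graph) → V G → ℕ
η G v = third (sortedReaches G v)

triodSize : Graph → ℕ
triodSize G = maxList (map (η G) (allFin (n G)))

-- Fix v with η(v) = k > 0 and three components C₁, C₂, C₃ of T − v containing vertices
-- x₁, x₂, x₃ at distance ≥ k from v. Since v separates Cᵢ from the rest of T, every vertex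
-- outside Cᵢ is at distance ≥ k from xᵢ, and T − Cᵢ is connected. So the pair (f, g) can
-- move keeping one coordinate at some xᵢ and the other outside Cᵢ: f tours T − C₃ while g
-- rests at x₃; g tours T − C₁ from x₃ to x₂ while f rests at x₁; f tours T − C₂ from x₁ to
-- x₃ while g rests at x₂; g tours T − C₃ while f rests at x₃. The components being
-- disjoint, f visits (T − C₃) ∪ (T − C₂) = T and g visits (T − C₁) ∪ (T − C₃) = T.
-- Finally 𝔥(T) is some η(v), and when it is 0 the diagonal f = g along a tour of T suffices.

module Submission where

open import Defs
open import Level using (0ℓ)
open import Data.Nat using (ℕ; zero; suc; _+_; _≤_; _<_; _≥_; _≤?_; _⊔_; z≤n; s≤s)
open import Data.Nat.Properties
  using ( module ≤-Reasoning; ≤-refl; ≤-trans; ≤-antisym; <⇒≤; ≤⇒≯; m≤n⇒m≤1+n; ⊔-sel; suc-injective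
        ; +-suc; +-identityʳ; ≤-decTotalOrder)
open import Data.Bool using (Bool; true; false; not; T; if_then_else_)
open import Data.Bool.Properties using (T?; T-∧; T-∨)
open import Data.Fin using (Fin; toℕ; inject₁; fromℕ; fromℕ<) renaming (zero to fzero; suc to fsuc)
open import Data.Fin.Properties using (toℕ-injective; toℕ-inject₁; injective⇒≤) renaming (_≟_ to _≟F_)
open import Data.List as List using (List; []; _∷_; map; filter; lookup; allFin; reverse)
open import Data.List.Relation.Unary.All as All using (All; []; _∷_)
open import Data.List.Relation.Unary.AllPairs using ([]; _∷_)
open import Data.List.Relation.Unary.Linked using (Linked; []; [-]; _∷_)
open import Data.List.Properties using (foldr-preservesᵇ; filter-accept; length-map)
open import Data.List.Relation.Binary.Permutation.Propositional using (_↭_; ↭-trans)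
open import Data.List.Relation.Binary.Permutation.Propositional.Properties using (↭-length; filter-↭; ↭-reverse)
open import Data.List.Sort.MergeSort ≤-decTotalOrder using (sort)
open import Data.List.Sort.MergeSort.Properties ≤-decTotalOrder using (sort-↭; sort-↗)
open import Data.List.Relation.Unary.Any as Any using (here; there)
open import Data.List.Relation.Unary.Any.Properties using (any⁺; any⁻; lookup-index)
open import Data.List.Relation.Unary.Unique.Propositional using (Unique)
import Data.List.Relation.Unary.Unique.Propositional.Properties as Uniqueₚ
open import Data.List.Relation.Unary.All.Properties.Core using (¬Any⇒All¬)
import Data.List.Relation.Unary.All.Properties as Allₚ
open import Data.List.Membership.Propositional using (_∈_; lose)
open import Data.List.Membership.Propositional.Properties using (∈-allFin; ∈-lookup; ∈-map⁺)
open import Data.Product using (Σ-syntax; ∃; _×_; _,_; proj₁; proj₂; map₂)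
open import Data.Product.Relation.Binary.Pointwise.NonDependent using (Pointwise)
open import Data.Sum using (_⊎_; inj₁; inj₂; [_,_]′)
open import Data.Empty using (⊥; ⊥-elim)
open import Data.Unit using (tt)
open import Function using (_∘_; Injective)
open import Function.Bundles using (Equivalence)
open import Relation.Binary using (Rel; Symmetric; DecidableEquality; _=[_]⇒_)
open import Relation.Unary using (Decidable)
open import Relation.Binary.Construct.Closure.ReflexiveTransitive using (Star; ε; _◅_; _◅◅_; gmap)
open import Relation.Binary.PropositionalEquality using (_≡_; _≢_; refl; sym; trans; cong; subst)
open import Relation.Nullary using (¬_; yes; no)
open import Relation.Nullary.Decidable using (⌊_⌋; toWitness; fromWitness)

open Equivalence using (to; from)

T-not⁺ : ∀ {b} → ¬ T b → T (not b)
T-not⁺ {false} _  = tt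
T-not⁺ {true}  ¬b = ¬b tt

T-not⁻ : ∀ {b} → T (not b) → ¬ T b
T-not⁻ {false} _ ()

module _ {A : Set} {R : Rel A 0ℓ} where

  -- Going through laterVertices makes List.length (vertices w) reduce to suc (length w).
  laterVertices : ∀ {x y} → Star R x y → List A

  vertices : ∀ {x y} → Star R x y → List A
  vertices {x} w = x ∷ laterVertices w

  laterVertices ε       = []
  laterVertices (_ ◅ w) = vertices w

  length : ∀ {x y} → Star R x y → ℕ
  length w = List.length (laterVertices w)

  end∈vertices : ∀ {x y} (w : Star R x y) → y ∈ vertices w
  end∈vertices ε       = here refl
  end∈vertices (_ ◅ w) = there (end∈vertices w)

  lookup-vertices-last : ∀ {x y} (w : Star R x y) → lookup (vertices w) (fromℕ (length w)) ≡ y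
  lookup-vertices-last ε       = refl
  lookup-vertices-last (_ ◅ w) = lookup-vertices-last w

  lookup-vertices-step : ∀ {x y} (w : Star R x y) (i : Fin (length w)) →
                         R (lookup (vertices w) (inject₁ i)) (lookup (vertices w) (fsuc i))
  lookup-vertices-step (r ◅ _) fzero    = r
  lookup-vertices-step (_ ◅ w) (fsuc i) = lookup-vertices-step w i

  ∈-◅◅⁺ˡ : ∀ {x y z u} (w : Star R x y) (w′ : Star R y z) →
           u ∈ vertices w → u ∈ vertices (w ◅◅ w′)
  ∈-◅◅⁺ˡ ε       w′ (here refl) = here refl
  ∈-◅◅⁺ˡ (_ ◅ w) w′ (here refl) = here refl
  ∈-◅◅⁺ˡ (_ ◅ w) w′ (there u∈w) = there (∈-◅◅⁺ˡ w w′ u∈w)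

  ∈-◅◅⁺ʳ : ∀ {x y z u} (w : Star R x y) {w′ : Star R y z} →
           u ∈ vertices w′ → u ∈ vertices (w ◅◅ w′)
  ∈-◅◅⁺ʳ ε       u∈w′ = u∈w′
  ∈-◅◅⁺ʳ (_ ◅ w) u∈w′ = there (∈-◅◅⁺ʳ w u∈w′)

  All-◅◅ : ∀ {P : A → Set} {x y z} (w : Star R x y) {w′ : Star R y z} →
           All P (vertices w) → All P (vertices w′) → All P (vertices (w ◅◅ w′))
  All-◅◅ ε       _          Pw′ = Pw′
  All-◅◅ (_ ◅ w) (Px ∷ Pw) Pw′ = Px ∷ All-◅◅ w Pw Pw′

  module _ (_≟_ : DecidableEquality A) where
    open import Data.List.Membership.DecPropositional _≟_ using (_∈?_)

    suffixFrom : ∀ {x y u} (w : Star R x y) → Unique (vertices w) → u ∈ vertices w →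
                 Σ[ w′ ∈ Star R u y ] Unique (vertices w′)
    suffixFrom w       uniq        (here refl) = w , uniq
    suffixFrom (_ ◅ w) (_ ∷ uniq) (there u∈w) = suffixFrom w uniq u∈w

    loopless : ∀ {x y} → Star R x y → Σ[ w′ ∈ Star R x y ] Unique (vertices w′)
    loopless ε = ε , [] ∷ []
    loopless {x} (r ◅ w) with loopless w
    ... | w′ , uniq with x ∈? vertices w′
    ...   | yes x∈w′ = suffixFrom w′ uniq x∈w′
    ...   | no  x∉w′ = r ◅ w′ , ¬Any⇒All¬ _ x∉w′ ∷ uniq

module _ {A B : Set} {R : Rel A 0ℓ} {R′ : Rel B 0ℓ} {f : A → B} {g : R =[ f ]⇒ R′} where

  vertices-gmap : ∀ {x y} (w : Star R x y) → vertices (gmap {U = R′} f g w) ≡ map f (vertices w)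
  vertices-gmap ε           = refl
  vertices-gmap {x} (_ ◅ w) = cong (f x ∷_) (vertices-gmap w)

  ∈-gmap⁺ : ∀ {x y u} (w : Star R x y) → u ∈ vertices w → f u ∈ vertices (gmap {U = R′} f g w)
  ∈-gmap⁺ {u = u} w u∈w = subst (f u ∈_) (sym (vertices-gmap w)) (∈-map⁺ f u∈w)

  All-gmap⁺ : ∀ {P : B → Set} {x y} (w : Star R x y) →
              All (P ∘ f) (vertices w) → All P (vertices (gmap {U = R′} f g w))
  All-gmap⁺ w Pw = subst (All _) (sym (vertices-gmap w)) (Allₚ.map⁺ Pw)

lookup-injective : ∀ {A : Set} {xs : List A} → Unique xs → Injective _≡_ _≡_ (lookup xs)
lookup-injective {xs = _ ∷ _} (_ ∷ _)       {fzero}  {fzero}  _ = refl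
lookup-injective {xs = _ ∷ _} (x∉xs ∷ _)    {fzero}  {fsuc j} e = ⊥-elim (All.lookup x∉xs (∈-lookup j) e)
lookup-injective {xs = _ ∷ _} (x∉xs ∷ _)    {fsuc i} {fzero}  e = ⊥-elim (All.lookup x∉xs (∈-lookup i) (sym e))
lookup-injective {xs = _ ∷ _} (_ ∷ uniq)    {fsuc i} {fsuc j} e = cong fsuc (lookup-injective uniq e)

shorten : ∀ {n} {R : Rel (Fin n) 0ℓ} {x y} → Star R x y → Σ[ w ∈ Star R x y ] length w < n
shorten w with w′ , uniq ← loopless _≟F_ w = w′ , injective⇒≤ (lookup-injective uniq)

consecutive⇒inject₁-suc : ∀ {m} {i j : Fin (suc m)} → suc (toℕ i) ≡ toℕ j →
                          ∃ λ l → i ≡ inject₁ l × j ≡ fsuc l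
consecutive⇒inject₁-suc {j = fsuc l} eq =
  l , toℕ-injective (trans (suc-injective eq) (sym (toℕ-inject₁ l))) , refl

Path-adj⁻ : ∀ {m} {i j : Fin (suc m)} → T (adj (Path m) i j) →
            (∃ λ l → i ≡ inject₁ l × j ≡ fsuc l) ⊎ (∃ λ l → j ≡ inject₁ l × i ≡ fsuc l)
Path-adj⁻ {i = i} {j} h with to (T-∨ {⌊ suc (toℕ i) Data.Nat.≟ toℕ j ⌋}) h
... | inj₁ i+1≡j = inj₁ (consecutive⇒inject₁-suc (toWitness i+1≡j))
... | inj₂ j+1≡i = inj₂ (consecutive⇒inject₁-suc (toWitness j+1≡i))

lookup-vertices-adj : ∀ {A : Set} {R : Rel A 0ℓ} → Symmetric R → ∀ {x y} (w : Star R x y) {i j} →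
                      T (adj (Path (length w)) i j) → R (lookup (vertices w) i) (lookup (vertices w) j)
lookup-vertices-adj R-sym w {i} {j} h with Path-adj⁻ {i = i} {j} h
... | inj₁ (l , refl , refl) = lookup-vertices-step w l
... | inj₂ (l , refl , refl) = R-sym (lookup-vertices-step w l)

least-≤ : ∀ p b {j} → T (p j) → least p b ≤ j
least-≤ p zero    _ = z≤n
least-≤ p (suc b) {j} pj with p zero in eq
least-≤ p (suc b) {j}     pj | true  = z≤n
least-≤ p (suc b) {zero}  pj | false = ⊥-elim (subst T eq pj)
least-≤ p (suc b) {suc j} pj | false = s≤s (least-≤ (p ∘ suc) b pj)

least-≤-bound : ∀ p b → least p b ≤ b
least-≤-bound p zero    = z≤n
least-≤-bound p (suc b) with p zero
... | true  = z≤n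
... | false = s≤s (least-≤-bound (p ∘ suc) b)

≤-least : ∀ p b {k} → k ≤ b → (∀ {j} → j < k → ¬ T (p j)) → k ≤ least p b
≤-least p b       {zero}  _         _     = z≤n
≤-least p (suc b) {suc k} (s≤s k≤b) below with p zero in eq
... | true  = ⊥-elim (below (s≤s z≤n) (subst T (sym eq) tt))
... | false = s≤s (≤-least (p ∘ suc) b k≤b (below ∘ s≤s))

maxList-preserves : ∀ {P : ℕ → Set} {xs} → P 0 → All P xs → P (maxList xs)
maxList-preserves {P} = foldr-preservesᵇ ⊔-preserves
  where
  ⊔-preserves : ∀ {x y} → P x → P y → P (x ⊔ y)
  ⊔-preserves {x} {y} Px Py = [ (λ eq → subst P (sym eq) Px) , (λ eq → subst P (sym eq) Py) ]′ (⊔-sel x y)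

reverse-descending : ∀ {xs} → Linked _≤_ xs → Linked _≥_ (reverse xs)
reverse-descending {[]}     _  = []
reverse-descending {x ∷ xs} ≤xs = go xs [] ≤xs [-]
  where
  go : ∀ {x} xs acc → Linked _≤_ (x ∷ xs) → Linked _≥_ (x ∷ acc) →
       Linked _≥_ (List.reverseAcc (x ∷ acc) xs)
  go []       acc _              ≥acc = ≥acc
  go (y ∷ ys) acc (x≤y ∷ ≤ys) ≥acc = go ys (_ ∷ acc) ≤ys (x≤y ∷ ≥acc)

three-≥-third : ∀ {xs} → Linked _≥_ xs → 0 < third xs → 3 ≤ List.length (filter (third xs ≤?_) xs)
three-≥-third {x ∷ y ∷ z ∷ zs} (y≤x ∷ z≤y ∷ _) _
  rewrite filter-accept (z ≤?_) {xs = y ∷ z ∷ zs} (≤-trans z≤y y≤x)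
        | filter-accept (z ≤?_) {xs = z ∷ zs} z≤y
        | filter-accept (z ≤?_) {xs = zs} (≤-refl {z}) = s≤s (s≤s (s≤s z≤n))

filter-map : ∀ {A : Set} {P : ℕ → Set} (P? : Decidable P) (f : A → ℕ) xs →
             filter P? (map f xs) ≡ map f (filter (P? ∘ f) xs)
filter-map P? f []       = refl
filter-map P? f (x ∷ xs) with P? (f x)
... | yes _ = cong (f x ∷_) (filter-map P? f xs)
... | no  _ = filter-map P? f xs

count-≥-third : ∀ {A : Set} (f : A → ℕ) xs {k} → third (reverse (sort (map f xs))) ≡ suc k →
                3 ≤ List.length (filter (λ a → suc k ≤? f a) xs)
count-≥-third f xs {k} third≡ = begin
  3                                             ≤⟨ three-≥-third (reverse-descending (sort-↗ fxs)) 0<third ⟩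
  List.length (filter (third sorted ≤?_) sorted) ≡⟨ cong (λ m → List.length (filter (m ≤?_) sorted)) third≡ ⟩
  List.length (filter (suc k ≤?_) sorted)        ≡⟨ ↭-length (filter-↭ (suc k ≤?_) sorted↭fxs) ⟩
  List.length (filter (suc k ≤?_) fxs)           ≡⟨ cong List.length (filter-map (suc k ≤?_) f xs) ⟩
  List.length (map f large)                      ≡⟨ length-map f large ⟩
  List.length large                              ∎
  where
  open ≤-Reasoning
  fxs    = map f xs
  sorted = reverse (sort fxs)
  large  = filter (λ a → suc k ≤? f a) xs
  sorted↭fxs : sorted ↭ fxs
  sorted↭fxs = ↭-trans (↭-reverse (sort fxs)) (sort-↭ fxs)
  0<third : 0 < third sorted
  0<third = subst (0 <_) (sym third≡) (s≤s z≤n)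

reach-witness : ∀ G {v a k} → suc k ≤ reach G v a → ∃ λ x → T (inComp G v a x) × suc k ≤ dist G v x
reach-witness G {v} {a} {k} =
  maxList-preserves {P = Witnessed} (λ ()) (Allₚ.map⁺ (All.universal witness (allFin (n G))))
  where
  Witnessed : ℕ → Set
  Witnessed m = suc k ≤ m → ∃ λ x → T (inComp G v a x) × suc k ≤ dist G v x
  witness : ∀ u → Witnessed (if inComp G v a u then dist G v u else 0)
  witness u with inComp G v a u in eq
  ... | true  = λ k<d → u , subst T (sym eq) tt , k<d
  ... | false = λ ()

module _ (G : Graph) (adj-sym : ∀ x y → adj G x y ≡ adj G y x) where

  Adj : Rel (V G) 0ℓ
  Adj x y = T (adj G x y)

  Adj-sym : Symmetric Adj
  Adj-sym {x} {y} = subst T (adj-sym x y)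

  -- A walk within S is a Star (Step S) together with the membership of its start in S.
  Step : (V G → Bool) → Rel (V G) 0ℓ
  Step S x y = Adj x y × T (S y)

  Walk : Rel (V G) 0ℓ
  Walk = Star (Step (everywhere G))

  ConnectedWithin : (V G → Bool) → Set
  ConnectedWithin S = ∀ {u u′} → T (S u) → T (S u′) → Star (Step S) u u′

  vertices-within : ∀ {S x y} → T (S x) → (w : Star (Step S) x y) → All (T ∘ S) (vertices w)
  vertices-within Sx ε              = Sx ∷ []
  vertices-within Sx ((_ , Sz) ◅ w) = Sx ∷ vertices-within Sz w

  revApp-within : ∀ {S x y z} → T (S x) → Star (Step S) x y → Star (Step S) x z → Star (Step S) y z
  revApp-within Sx ε              acc = acc
  revApp-within Sx ((e , Sz) ◅ w) acc = revApp-within Sz w ((Adj-sym e , Sx) ◅ acc)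

  length-revApp-within : ∀ {S x y z} (Sx : T (S x)) (w : Star (Step S) x y) (acc : Star (Step S) x z) →
                             length (revApp-within Sx w acc) ≡ length w + length acc
  length-revApp-within Sx ε              acc = refl
  length-revApp-within Sx ((e , Sz) ◅ w) acc =
    trans (length-revApp-within Sz w _) (+-suc (length w) (length acc))

  reverse-within : ∀ {S x y} → T (S x) → Star (Step S) x y → Star (Step S) y x
  reverse-within Sx w = revApp-within Sx w ε

  length-reverse-within : ∀ {S x y} (Sx : T (S x)) (w : Star (Step S) x y) →
                          length (reverse-within Sx w) ≡ length w
  length-reverse-within Sx w = trans (length-revApp-within Sx w ε) (+-identityʳ (length w))

  walkB-sound : ∀ S j {x y} → T (walkB G S j x y) → T (S x) × Σ[ w ∈ Star (Step S) x y ] length w ≤ j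
  walkB-sound S zero {x} {y} h with Sx , x≡y ← to T-∧ h with refl ← toWitness {a? = x ≟F y} x≡y =
    Sx , ε , z≤n
  walkB-sound S (suc j) {x} {y} h with to (T-∨ {walkB G S j x y}) h
  ... | inj₁ h′ with Sx , w , w≤j ← walkB-sound S j h′ = Sx , w , m≤n⇒m≤1+n w≤j
  ... | inj₂ h′ =
    let Sx , h″     = to T-∧ h′
        z , step    = Any.satisfied (any⁻ _ (allFin (n G)) h″)
        e , h‴      = to T-∧ step
        Sz , w , w≤j = walkB-sound S j h‴
    in Sx , (e , Sz) ◅ w , s≤s w≤j

  walkB-complete : ∀ S j {x y} → T (S x) → (w : Star (Step S) x y) → length w ≤ j → T (walkB G S j x y)
  walkB-complete S zero    {x} Sx ε _ = from T-∧ (Sx , fromWitness {a? = x ≟F x} refl)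
  walkB-complete S (suc j) {x} {y} Sx ε _ = from (T-∨ {walkB G S j x y}) (inj₁ (walkB-complete S j Sx ε z≤n))
  walkB-complete S (suc j) {x} {y} Sx (_◅_ {j = z} (e , Sz) w) (s≤s w≤j) =
    from (T-∨ {walkB G S j x y}) (inj₂ (from T-∧ (Sx , any⁺ _ (lose (∈-allFin z)
      (from T-∧ (e , walkB-complete S j Sz w w≤j))))))

  walkB-within : ∀ S {x y} → T (S x) → Star (Step S) x y → T (walkB G S (n G) x y)
  walkB-within S Sx w with w′ , w′<n ← shorten w = walkB-complete S (n G) Sx w′ (<⇒≤ w′<n)

  Connected⇒ConnectedWithin : Connected G → ConnectedWithin (everywhere G)
  Connected⇒ConnectedWithin connected {x} {y} _ _ =
    proj₁ (proj₂ (walkB-sound (everywhere G) (n G) (connected x y)))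

  dist-≤-length : ∀ {x y} (w : Walk x y) → dist G x y ≤ length w
  dist-≤-length {x} {y} w = least-≤ (λ j → walkB G (everywhere G) j x y) (n G)
                              (walkB-complete (everywhere G) (length w) tt w ≤-refl)

  ≤-dist : ∀ {x y k} → k ≤ n G → (∀ (w : Walk x y) → k ≤ length w) → k ≤ dist G x y
  ≤-dist {x} {y} k≤n long = ≤-least (λ j → walkB G (everywhere G) j x y) (n G) k≤n λ j<k h →
    let _ , w , w≤j = walkB-sound (everywhere G) _ h in ≤⇒≯ (≤-trans (long w) w≤j) j<k

  dist-sym : ∀ x y → dist G x y ≡ dist G y x
  dist-sym x y = ≤-antisym (dist-≤-reverse x y) (dist-≤-reverse y x)
    where
    dist-≤-reverse : ∀ x y → dist G x y ≤ dist G y x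
    dist-≤-reverse x y = ≤-dist (least-≤-bound _ (n G)) λ w →
      subst (dist G x y ≤_) (length-reverse-within tt w) (dist-≤-length (reverse-within tt w))

  covering-walk : ∀ {S s t} → ConnectedWithin S → T (S s) → T (S t) →
                  Σ[ w ∈ Star (Step S) s t ] (∀ {y} → T (S y) → y ∈ vertices w)
  covering-walk {S} {s} connected Ss St =
    let tour , covers = visit (allFin (n G))
    in tour ◅◅ connected Ss St , λ Sy → ∈-◅◅⁺ˡ tour _ (covers (∈-allFin _) Sy)
    where
    visit : ∀ ys → Σ[ w ∈ Star (Step S) s s ] (∀ {y} → y ∈ ys → T (S y) → y ∈ vertices w)
    visit []       = ε , λ ()
    visit (y ∷ ys) with visit ys | T? (S y)
    ... | tour , covers | no ¬Sy = tour , λ { (here refl) Sy → ⊥-elim (¬Sy Sy) ; (there y∈ys) → covers y∈ys }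
    ... | tour , covers | yes Sy =
      let there-and-back = connected Ss Sy ◅◅ connected Sy Ss
      in there-and-back ◅◅ tour ,
         λ { (here refl) _ → ∈-◅◅⁺ˡ there-and-back tour (∈-◅◅⁺ˡ (connected Ss Sy) _ (end∈vertices _))
           ; (there y∈ys) Sy′ → ∈-◅◅⁺ʳ there-and-back (covers y∈ys Sy′) }

  WeakAdj : Rel (V G) 0ℓ
  WeakAdj x y = Adj x y ⊎ x ≡ y

  PairStep : Rel (V G × V G) 0ℓ
  PairStep = Pointwise WeakAdj WeakAdj

  PairStep-sym : Symmetric PairStep
  PairStep-sym (a , b) = weak-sym a , weak-sym b
    where
    weak-sym : Symmetric WeakAdj
    weak-sym (inj₁ e)  = inj₁ (Adj-sym e)
    weak-sym (inj₂ eq) = inj₂ (sym eq)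

  FarApart : ℕ → V G × V G → Set
  FarApart k (x , y) = k ≤ dist G x y

  svs-from-pair-walk : ∀ {k p q} (w : Star PairStep p q) → All (FarApart k) (vertices w) →
                       (∀ y → ∃ λ b → (y , b) ∈ vertices w) →
                       (∀ y → ∃ λ a → (a , y) ∈ vertices w) →
                       SvsAtLeast G k
  svs-from-pair-walk w far covers₁ covers₂ =
    length w , proj₁ ∘ pair , proj₂ ∘ pair ,
    (λ i j → proj₁ ∘ lookup-vertices-adj PairStep-sym w {i} {j}) ,
    (λ y → map₂ (cong proj₁) (visited (proj₂ (covers₁ y)))) ,
    (λ i j → proj₂ ∘ lookup-vertices-adj PairStep-sym w {i} {j}) ,
    (λ y → map₂ (cong proj₂) (visited (proj₂ (covers₂ y)))) ,
    λ i → All.lookup far (∈-lookup i)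
    where
    pair = lookup (vertices w)
    visited : ∀ {p} → p ∈ vertices w → ∃ λ i → pair i ≡ p
    visited p∈w = Any.index p∈w , sym (lookup-index p∈w)

  svs-zero : Connected G → V G → SvsAtLeast G 0
  svs-zero connected s = svs-from-pair-walk diagonal (All-gmap⁺ tour (All.universal (λ _ → z≤n) _))
                           (λ y → y , on-diagonal y) (λ y → y , on-diagonal y)
    where
    covering = covering-walk {s = s} {s} (Connected⇒ConnectedWithin connected) tt tt
    tour = proj₁ covering
    diagonal : Star PairStep (s , s) (s , s)
    diagonal = gmap (λ u → u , u) (λ (e , _) → inj₁ e , inj₁ e) tour
    on-diagonal : ∀ y → (y , y) ∈ vertices diagonal
    on-diagonal y = ∈-gmap⁺ tour (proj₂ covering tt)

  module Cut (v : V G) (C : V G → Bool) (C-closed : ∀ {z u} → T (C z) → Adj z u → u ≢ v → T (C u)) where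

    enter-through-cut : ∀ {u x} → ¬ T (C u) → T (C x) → (w : Walk u x) →
                        Σ[ w′ ∈ Walk v x ] length w′ ≤ length w
    enter-through-cut {u} ¬Cu Cx w with u ≟F v
    ... | yes refl = w , ≤-refl
    enter-through-cut ¬Cu Cx ε              | no _   = ⊥-elim (¬Cu Cx)
    enter-through-cut ¬Cu Cx ((e , _) ◅ w)  | no u≢v =
      map₂ m≤n⇒m≤1+n (enter-through-cut (λ Cz → ¬Cu (C-closed Cz (Adj-sym e) u≢v)) Cx w)

    dist-through-cut : ∀ {u x} → ¬ T (C u) → T (C x) → dist G v x ≤ dist G u x
    dist-through-cut ¬Cu Cx = ≤-dist (least-≤-bound _ (n G)) λ w →
      let w′ , w′≤w = enter-through-cut ¬Cu Cx w in ≤-trans (dist-≤-length w′) w′≤w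

    walk-to-cut-outside : ∀ {u} → ¬ T (C u) → Walk u v → Star (Step (not ∘ C)) u v
    walk-to-cut-outside {u} ¬Cu w with u ≟F v
    ... | yes refl = ε
    walk-to-cut-outside ¬Cu ε             | no u≢v = ⊥-elim (u≢v refl)
    walk-to-cut-outside ¬Cu ((e , _) ◅ w) | no u≢v =
      let ¬Cz = λ Cz → ¬Cu (C-closed Cz (Adj-sym e) u≢v) in (e , T-not⁺ ¬Cz) ◅ walk-to-cut-outside ¬Cz w

    outside-connected : Connected G → ConnectedWithin (not ∘ C)
    outside-connected connected {u} {u′} Ou Ou′ =
      walk-to-cut-outside (T-not⁻ Ou) (walk u v) ◅◅
      reverse-within Ou′ (walk-to-cut-outside (T-not⁻ Ou′) (walk u′ v))
      where
      walk : ∀ x y → Walk x y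
      walk x y = Connected⇒ConnectedWithin connected tt tt

  -- Abstracts a component of T − v, given by its complement, together with a far vertex of it.
  record Branch (k : ℕ) : Set where
    field
      outside           : V G → Bool
      tip               : V G
      tip-inside        : ¬ T (outside tip)
      far               : ∀ {u} → T (outside u) → k ≤ dist G u tip
      outside-connected : ConnectedWithin outside

  Disjoint : ∀ {k} → Branch k → Branch k → Set
  Disjoint b b′ = ∀ u → T (Branch.outside b u) ⊎ T (Branch.outside b′ u)

  module _ {k : ℕ} where
    open Branch

    tip-outsideʳ : {b b′ : Branch k} → Disjoint b b′ → T (outside b′ (tip b))
    tip-outsideʳ {b} disjoint with disjoint (tip b)
    ... | inj₁ out = ⊥-elim (tip-inside b out)
    ... | inj₂ out = out

    tip-outsideˡ : {b b′ : Branch k} → Disjoint b b′ → T (outside b (tip b′))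
    tip-outsideˡ {b′ = b′} disjoint with disjoint (tip b′)
    ... | inj₁ out = out
    ... | inj₂ out = ⊥-elim (tip-inside b′ out)

    moveFirst : ∀ {S a a′} → Star (Step S) a a′ → (c : V G) → Star PairStep (a , c) (a′ , c)
    moveFirst w c = gmap (_, c) (λ (e , _) → inj₁ e , inj₂ refl) w

    moveSecond : ∀ {S a a′} (c : V G) → Star (Step S) a a′ → Star PairStep (c , a) (c , a′)
    moveSecond c w = gmap (c ,_) (λ (e , _) → inj₂ refl , inj₁ e) w

    moveFirst-far : (b : Branch k) {s t : V G} → T (outside b s) → (w : Star (Step (outside b)) s t) →
                    All (FarApart k) (vertices (moveFirst w (tip b)))
    moveFirst-far b Os w = All-gmap⁺ w (All.map (far b) (vertices-within Os w))

    moveSecond-far : (b : Branch k) {s t : V G} → T (outside b s) → (w : Star (Step (outside b)) s t) →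
                     All (FarApart k) (vertices (moveSecond (tip b) w))
    moveSecond-far b Os w =
      All-gmap⁺ w (All.map (λ Ou → subst (k ≤_) (dist-sym _ _) (far b Ou)) (vertices-within Os w))

    svs-from-branches : (b₁ b₂ b₃ : Branch k) →
                        Disjoint b₁ b₂ → Disjoint b₁ b₃ → Disjoint b₂ b₃ → SvsAtLeast G k
    svs-from-branches b₁ b₂ b₃ d₁₂ d₁₃ d₂₃ =
      svs-from-pair-walk tours
        (All-◅◅ phase₁ (moveFirst-far b₃ x₁∈O₃ W₁)
          (All-◅◅ phase₂ (moveSecond-far b₁ x₃∈O₁ W₂)
            (All-◅◅ phase₃ (moveFirst-far b₂ x₁∈O₂ W₃) (moveSecond-far b₃ x₂∈O₃ W₄))))
        covers₁ covers₂
      where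
      x₁ = tip b₁
      x₂ = tip b₂
      x₃ = tip b₃
      x₁∈O₂ = tip-outsideʳ {b₁} {b₂} d₁₂
      x₁∈O₃ = tip-outsideʳ {b₁} {b₃} d₁₃
      x₂∈O₁ = tip-outsideˡ {b₁} {b₂} d₁₂
      x₂∈O₃ = tip-outsideʳ {b₂} {b₃} d₂₃
      x₃∈O₁ = tip-outsideˡ {b₁} {b₃} d₁₃
      x₃∈O₂ = tip-outsideˡ {b₂} {b₃} d₂₃
      tour : (b : Branch k) {s t : V G} → T (outside b s) → T (outside b t) → Star (Step (outside b)) s t
      tour b Os Ot = proj₁ (covering-walk (outside-connected b) Os Ot)
      toured : (b : Branch k) {s t y : V G} (Os : T (outside b s)) (Ot : T (outside b t)) →
               T (outside b y) → y ∈ vertices (tour b Os Ot)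
      toured b Os Ot = proj₂ (covering-walk (outside-connected b) Os Ot)
      W₁ = tour b₃ x₁∈O₃ x₁∈O₃
      W₂ = tour b₁ x₃∈O₁ x₂∈O₁
      W₃ = tour b₂ x₁∈O₂ x₃∈O₂
      W₄ = tour b₃ x₂∈O₃ x₂∈O₃
      phase₁ = moveFirst W₁ x₃
      phase₂ = moveSecond x₁ W₂
      phase₃ = moveFirst W₃ x₂
      phase₄ = moveSecond x₃ W₄
      tours = phase₁ ◅◅ phase₂ ◅◅ phase₃ ◅◅ phase₄
      covers₁ : ∀ y → ∃ λ c → (y , c) ∈ vertices tours
      covers₁ y with d₂₃ y
      ... | inj₁ y∈O₂ = x₂ , ∈-◅◅⁺ʳ phase₁ (∈-◅◅⁺ʳ phase₂ (∈-◅◅⁺ˡ phase₃ phase₄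
                               (∈-gmap⁺ W₃ (toured b₂ x₁∈O₂ x₃∈O₂ y∈O₂))))
      ... | inj₂ y∈O₃ = x₃ , ∈-◅◅⁺ˡ phase₁ _ (∈-gmap⁺ W₁ (toured b₃ x₁∈O₃ x₁∈O₃ y∈O₃))
      covers₂ : ∀ y → ∃ λ c → (c , y) ∈ vertices tours
      covers₂ y with d₁₃ y
      ... | inj₁ y∈O₁ = x₁ , ∈-◅◅⁺ʳ phase₁ (∈-◅◅⁺ˡ phase₂ _
                               (∈-gmap⁺ W₂ (toured b₁ x₃∈O₁ x₂∈O₁ y∈O₁)))
      ... | inj₂ y∈O₃ = x₃ , ∈-◅◅⁺ʳ phase₁ (∈-◅◅⁺ʳ phase₂ (∈-◅◅⁺ʳ phase₃
                               (∈-gmap⁺ W₄ (toured b₃ x₂∈O₃ x₂∈O₃ y∈O₃))))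

  avoid⁺ : ∀ {v x} → x ≢ v → T (avoid G v x)
  avoid⁺ x≢v = T-not⁺ (x≢v ∘ toWitness)

  avoid⁻ : ∀ {v x} → T (avoid G v x) → x ≢ v
  avoid⁻ h x≡v = T-not⁻ h (fromWitness x≡v)

  component-walk : ∀ {v a u} → T (inComp G v a u) → T (avoid G v a) × Star (Step (avoid G v)) a u
  component-walk {v} Cu = map₂ proj₁ (walkB-sound (avoid G v) (n G) Cu)

  component-closed : ∀ {v a z u} → T (inComp G v a z) → Adj z u → u ≢ v → T (inComp G v a u)
  component-closed {v} Cz e u≢v =
    let Sa , w = component-walk Cz in walkB-within (avoid G v) Sa (w ◅◅ (e , avoid⁺ u≢v) ◅ ε)

  component-branch : Connected G → ∀ {v a x k} → T (inComp G v a x) → k ≤ dist G v x → Branch k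
  component-branch connected {v} {a} {x} Cx k≤vx = record
    { outside           = not ∘ inComp G v a
    ; tip               = x
    ; tip-inside        = λ Ox → T-not⁻ Ox Cx
    ; far               = λ Ou → ≤-trans k≤vx (dist-through-cut (T-not⁻ Ou) Cx)
    ; outside-connected = outside-connected connected
    }
    where open Cut v (inComp G v a) component-closed

  cycle-through : ∀ {v b c} → b ≢ c → Adj v b → Adj v c → T (avoid G v b) →
                  (w : Star (Step (avoid G v)) b c) → Unique (vertices w) → HasCycle G
  cycle-through b≢c _ _ _ ε _ = ⊥-elim (b≢c refl)
  cycle-through {v} _ vb vc Sb (e ◅ w) uniq =
    length w , lookup cycle , (λ _ _ → lookup-injective (v∉cycle ∷ uniq)) , edges , closing
    where
    cycle = v ∷ vertices (e ◅ w)
    v∉cycle : All (v ≢_) (vertices (e ◅ w))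
    v∉cycle = All.map (λ h → avoid⁻ h ∘ sym) (vertices-within Sb (e ◅ w))
    edges : ∀ i → Adj (lookup cycle (inject₁ i)) (lookup cycle (fsuc i))
    edges fzero    = vb
    edges (fsuc i) = proj₁ (lookup-vertices-step (e ◅ w) i)
    closing : Adj (lookup cycle (fromℕ (suc (length (e ◅ w))))) v
    closing = subst (λ z → Adj z v) (sym (lookup-vertices-last (e ◅ w))) (Adj-sym vc)

  components-disjoint : (HasCycle G → ⊥) → ∀ {v b c u} → b ≢ c → Adj v b → Adj v c →
                        T (inComp G v b u) → ¬ T (inComp G v c u)
  components-disjoint acyclic b≢c vb vc Cbu Ccu =
    let Sb , p     = component-walk Cbu
        Sc , q     = component-walk Ccu
        w , uniq   = loopless _≟F_ (p ◅◅ reverse-within Sc q)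
    in acyclic (cycle-through b≢c vb vc Sb w uniq)

  module _ (connected : Connected G) (acyclic : HasCycle G → ⊥) where

    LargeNeighbour : V G → ℕ → V G → Set
    LargeNeighbour v k a = Adj v a × suc k ≤ reach G v a

    large-neighbour-branch : ∀ {v k a} → LargeNeighbour v k a → Branch (suc k)
    large-neighbour-branch (_ , large) = let _ , Cx , far = reach-witness G large in component-branch connected Cx far

    large-neighbours-disjoint : ∀ {v k a b} → a ≢ b →
                                (la : LargeNeighbour v k a) (lb : LargeNeighbour v k b) →
                                Disjoint (large-neighbour-branch la) (large-neighbour-branch lb)
    large-neighbours-disjoint {v} {a = a} a≢b (va , _) (vb , _) u with T? (inComp G v a u)
    ... | yes Ca = inj₂ (T-not⁺ (components-disjoint acyclic a≢b va vb Ca))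
    ... | no ¬Ca = inj₁ (T-not⁺ ¬Ca)

    svs-from-large-neighbours : ∀ {v k} (as : List (V G)) → Unique as → 3 ≤ List.length as →
                                All (LargeNeighbour v k) as → SvsAtLeast G (suc k)
    svs-from-large-neighbours (a₁ ∷ a₂ ∷ a₃ ∷ _) ((a₁≢a₂ ∷ a₁≢a₃ ∷ _) ∷ (a₂≢a₃ ∷ _) ∷ _) _
                              (l₁ ∷ l₂ ∷ l₃ ∷ _) =
      svs-from-branches (large-neighbour-branch l₁) (large-neighbour-branch l₂) (large-neighbour-branch l₃)
        (large-neighbours-disjoint a₁≢a₂ l₁ l₂) (large-neighbours-disjoint a₁≢a₃ l₁ l₃)
        (large-neighbours-disjoint a₂≢a₃ l₂ l₃)
    svs-from-large-neighbours []           _ ()                _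
    svs-from-large-neighbours (_ ∷ [])     _ (s≤s ())          _
    svs-from-large-neighbours (_ ∷ _ ∷ []) _ (s≤s (s≤s ()))    _

    svs-at-vertex : ∀ v → SvsAtLeast G (η G v)
    svs-at-vertex v with η G v in η≡
    ... | zero  = svs-zero connected v
    ... | suc k = svs-from-large-neighbours large
                    (Uniqueₚ.filter⁺ _ (Uniqueₚ.filter⁺ _ (Uniqueₚ.allFin⁺ (n G))))
                    (count-≥-third (reach G v) (neighbours G v) η≡)
                    (All.zip (Allₚ.filter⁺ _ adjacent , Allₚ.all-filter _ (neighbours G v)))
      where
      large = filter (λ a → suc k ≤? reach G v a) (neighbours G v)
      adjacent : All (Adj v) (neighbours G v)
      adjacent = Allₚ.all-filter _ (allFin (n G))

proposition2p4 : (T : Graph) → IsTree T → SvsAtLeast T (triodSize T)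
proposition2p4 G ((adj-sym , _) , 1≤n , connected , acyclic) =
  maxList-preserves {P = SvsAtLeast G} (svs-zero G adj-sym connected (fromℕ< 1≤n))
    (Allₚ.map⁺ (All.universal (svs-at-vertex G adj-sym connected acyclic) (allFin (n G))))
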